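{- Let $T$ be a finite set of tense formulas with $\top,\bot\in T$, and let $n\geq m\geq 0$. For any formulas $\varphi,\psi$, if $\mathsf{G}\vdash\langle\varphi\rangle^n\Rightarrow_{T^\circ}\psi$, then there exists a formula $\gamma\in T^\circ$ with $\mathsf{G}\vdash\langle\varphi\rangle^m\Rightarrow_{T^\circ}\gamma$ and $\mathsf{G}\vdash\langle\gamma\rangle^{n-m}\Rightarrow_{T^\circ}\psi$.
   Context: Tense formulas are built from a countable set of propositional variables using $\bot,\top$, unary $\neg,\Diamond,\blacksquare$ and binary $\wedge,\vee$; $\Diamond^0\varphi=\varphi$, $\Diamond^{k+1}\varphi=\Diamond\Diamond^k\varphi$. Formula structures: $\langle\varphi\rangle^n$ is the formal expression obtained by applying a unary structural operator $\langle\cdot\rangle$ $n$ times to the formula $\varphi$ ($\langle\varphi\rangle^0=\varphi$); if $\Gamma=\langle\varphi\rangle^n$ then $\langle\Gamma\rangle^k=\langle\varphi\rangle^{n+k}$. A sequent is $\Gamma\Rightarrow\psi$, $\Gamma$ a formula structure, $\psi$ a formula. The calculus $\mathsf{G}$ has axioms (arbitrary formulas, $n\geq0$): $\varphi\Rightarrow\varphi$; $\varphi\wedge(\psi\vee\chi)\Rightarrow(\varphi\wedge\psi)\vee(\varphi\wedge\chi)$; $\varphi\Rightarrow\top$; $\langle\bot\rangle^n\Rightarrow\psi$; $\varphi\wedge\neg\varphi\Rightarrow\bot$; $\top\Rightarrow\varphi\vee\neg\varphi$; $\Diamond^3\varphi\Rightarrow\Diamond^2\varphi$; and rules (arbitrary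 $n\geq0$): from $\langle\varphi_i\rangle^n\Rightarrow\psi$ infer $\langle\varphi_1\wedge\varphi_2\rangle^n\Rightarrow\psi$ ($i=1,2$); from $\Gamma\Rightarrow\psi_1$, $\Gamma\Rightarrow\psi_2$ infer $\Gamma\Rightarrow\psi_1\wedge\psi_2$; from $\langle\varphi_1\rangle^n\Rightarrow\psi$, $\langle\varphi_2\rangle^n\Rightarrow\psi$ infer $\langle\varphi_1\vee\varphi_2\rangle^n\Rightarrow\psi$; from $\Gamma\Rightarrow\psi_i$ infer $\Gamma\Rightarrow\psi_1\vee\psi_2$; from $\langle\varphi\rangle^{n+1}\Rightarrow\psi$ infer $\langle\Diamond\varphi\rangle^n\Rightarrow\psi$; from $\Gamma\Rightarrow\psi$ infer $\langle\Gamma\rangle\Rightarrow\Diamond\psi$; from $\langle\varphi\rangle^n\Rightarrow\psi$ infer $\langle\blacksquare\varphi\rangle^{n+1}\Rightarrow\psi$; from $\langle\Gamma\rangle\Rightarrow\psi$ infer $\Gamma\Rightarrow\blacksquare\psi$; from $\Gamma\Rightarrow\varphi$ and $\langle\varphi\rangle^n\Rightarrow\psi$ infer $\langle\Gamma\rangle^n\Rightarrow\psi$ (Cut). A derivation is a finite tree of sequents each node of which is an axiom instance or obtained from its children by a rule. For a finite set $T$ of formulas with $\top,\bot\in T$: $T^\Diamond=\{\Diamond^k\varphi\mid\varphi\in T,\ 0\leq k\leq 3\}$, and $T^\circ$ is the smallest set of formulas containing $T^\Diamond$ and closed under $\neg,\wedge,\vee$. $\mathsf{G}\vdash\Gamma\Rightarrow_{T^\circ}\psi$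 means there is a derivation of $\Gamma\Rightarrow\psi$ in $\mathsf{G}$ all of whose formulas belong to $T^\circ$. -}

module Defs where

open import Data.Nat using (ℕ; zero; suc; _+_; _≤_)
open import Data.List using (List)
open import Data.List.Membership.Propositional using (_∈_)
open import Data.Product using (Σ; _×_)
open import Relation.Binary.PropositionalEquality using (_≡_)

data Fm : Set where
  var  : ℕ → Fm
  bot  : Fm
  top  : Fm
  neg  : Fm → Fm
  dia  : Fm → Fm
  bbox : Fm → Fm
  _∧ᶠ_ : Fm → Fm → Fm
  _∨ᶠ_ : Fm → Fm → Fm

infixr 6 _∧ᶠ_
infixr 5 _∨ᶠ_

dia^ : ℕ → Fm → Fm
dia^ zero    φ = φ
dia^ (suc k) φ = dia (dia^ k φ)

TDia : List Fm → Fm → Set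
TDia T χ = Σ Fm λ φ → Σ ℕ λ k → (φ ∈ T) × (k ≤ 3) × (χ ≡ dia^ k φ)

data TCirc (T : List Fm) : Fm → Set where
  base : ∀ {χ} → TDia T χ → TCirc T χ
  cneg : ∀ {χ} → TCirc T χ → TCirc T (neg χ)
  cand : ∀ {χ θ} → TCirc T χ → TCirc T θ → TCirc T (χ ∧ᶠ θ)
  cor  : ∀ {χ θ} → TCirc T χ → TCirc T θ → TCirc T (χ ∨ᶠ θ)

-- Sequents ⟨φ⟩^n ⇒ ψ are represented by the triple (φ, n, ψ).
-- Der P φ n ψ : a derivation in G of ⟨φ⟩^n ⇒ ψ all of whose sequents
-- have their formulas (φ and ψ) in P.  Every node of the derivation tree
-- is checked (node), and Step P φ n ψ gives the axiom / rule used at the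
-- node, with premises again being Der P-derivations.
mutual
  data Der (P : Fm → Set) : Fm → ℕ → Fm → Set where
    node : ∀ {φ n ψ} → P φ → P ψ → Step P φ n ψ → Der P φ n ψ

  data Step (P : Fm → Set) : Fm → ℕ → Fm → Set where
    ax-id    : ∀ {φ} → Step P φ 0 φ
    ax-dist  : ∀ {φ ψ χ} → Step P (φ ∧ᶠ (ψ ∨ᶠ χ)) 0 ((φ ∧ᶠ ψ) ∨ᶠ (φ ∧ᶠ χ))
    ax-top   : ∀ {φ} → Step P φ 0 top
    ax-bot   : ∀ {n ψ} → Step P bot n ψ
    ax-negL  : ∀ {φ} → Step P (φ ∧ᶠ neg φ) 0 bot
    ax-negR  : ∀ {φ} → Step P top 0 (φ ∨ᶠ neg φ)
    ax-dia   : ∀ {φ} → Step P (dia^ 3 φ) 0 (dia^ 2 φ)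
    ∧L₁ : ∀ {φ₁ φ₂ n ψ} → Der P φ₁ n ψ → Step P (φ₁ ∧ᶠ φ₂) n ψ
    ∧L₂ : ∀ {φ₁ φ₂ n ψ} → Der P φ₂ n ψ → Step P (φ₁ ∧ᶠ φ₂) n ψ
    ∧R  : ∀ {φ n ψ₁ ψ₂} → Der P φ n ψ₁ → Der P φ n ψ₂ → Step P φ n (ψ₁ ∧ᶠ ψ₂)
    ∨L  : ∀ {φ₁ φ₂ n ψ} → Der P φ₁ n ψ → Der P φ₂ n ψ → Step P (φ₁ ∨ᶠ φ₂) n ψ
    ∨R₁ : ∀ {φ n ψ₁ ψ₂} → Der P φ n ψ₁ → Step P φ n (ψ₁ ∨ᶠ ψ₂)
    ∨R₂ : ∀ {φ n ψ₁ ψ₂} → Der P φ n ψ₂ → Step P φ n (ψ₁ ∨ᶠ ψ₂)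
    ◇L  : ∀ {φ n ψ} → Der P φ (suc n) ψ → Step P (dia φ) n ψ
    ◇R  : ∀ {φ n ψ} → Der P φ n ψ → Step P φ (suc n) (dia ψ)
    ■L  : ∀ {φ n ψ} → Der P φ n ψ → Step P (bbox φ) (suc n) ψ
    ■R  : ∀ {φ n ψ} → Der P φ (suc n) ψ → Step P φ n (bbox ψ)
    cut : ∀ {φ k χ n ψ} → Der P φ k χ → Der P χ n ψ → Step P φ (k + n) ψ

_⊢G_⟨_⟩⇒_ : List Fm → Fm → ℕ → Fm → Set
T ⊢G φ ⟨ n ⟩⇒ ψ = Der (TCirc T) φ n ψ

module Submission where

-- If m = 0 take
-- γ = φ, if r = 0 take γ = ψ.  Otherwise the last rule acts either on the
-- left formula (∧L, ∨L, ◇L, ■L, ⊥-axiom), and the interpolant of its premise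
-- is reused with the rule applied to its left half, or on the right formula
-- (∧R, ∨R, ◇R, ■R), and the rule is applied to the right half.  The two-premise
-- rules ∨L and ∧R combine the two interpolants by ∨ resp. ∧; a cut is split
-- at the position where the m structural brackets end.  The remaining axioms
-- have no brackets and cannot occur when m, r > 0.
--
-- The argument only needs the admissible formulas to be closed under ∧ and ∨,
-- so it is carried out for an arbitrary such class P; the theorem is the
-- instance P = T°, with m + r = n.

open import Defs
open import Data.Nat using (ℕ; zero; suc; _+_; _≤_; _∸_)
open import Data.Nat.Properties using (+-suc; +-identityʳ; suc-injective; m+[n∸m]≡n)
open import Data.List using (List)
open import Data.List.Membership.Propositional using (_∈_)
open import Data.Product using (Σ; _×_; _,_)
open import Data.Sum using (_⊎_; inj₁; inj₂)
open import Relation.Binary.PropositionalEquality using (_≡_; refl; sym; cong; subst)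

-- This locates the
-- split of a bracket depth m + r inside a cut of depths k and j.
split-sum : ∀ m r k j → m + r ≡ k + j →
  (Σ ℕ λ t → (m + t ≡ k) × (t + j ≡ r)) ⊎ (Σ ℕ λ t → (k + t ≡ m) × (t + r ≡ j))
split-sum zero    r k       j e = inj₁ (k , refl , sym e)
split-sum (suc m) r zero    j e = inj₂ (suc m , refl , e)
split-sum (suc m) r (suc k) j e with split-sum m r k j (suc-injective e)
... | inj₁ (t , m+t≡k , t+j≡r) = inj₁ (t , cong suc m+t≡k , t+j≡r)
... | inj₂ (t , k+t≡m , t+r≡j) = inj₂ (t , cong suc k+t≡m , t+r≡j)

module Interpolation
  (P : Fm → Set)
  (P-∧ : ∀ {χ θ} → P χ → P θ → P (χ ∧ᶠ θ))
  (P-∨ : ∀ {χ θ} → P χ → P θ → P (χ ∨ᶠ θ))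
  where

  antecedent-in : ∀ {φ n ψ} → Der P φ n ψ → P φ
  antecedent-in (node pφ _ _) = pφ

  succedent-in : ∀ {φ n ψ} → Der P φ n ψ → P ψ
  succedent-in (node _ pψ _) = pψ

  identity : ∀ {φ} → P φ → Der P φ 0 φ
  identity pφ = node pφ pφ ax-id

  record Interpolant (φ : Fm) (m r : ℕ) (ψ : Fm) : Set where
    constructor interpolant
    field
      γ     : Fm
      γ∈P   : P γ
      left  : Der P φ m γ
      right : Der P γ r ψ

  extend-left : ∀ {φ φ′ m m′ r ψ} → P φ →
    (∀ {γ} → Der P φ′ m′ γ → Step P φ m γ) →
    Interpolant φ′ m′ r ψ → Interpolant φ m r ψ
  extend-left pφ rule (interpolant γ pγ l r) = interpolant γ pγ (node pφ pγ (rule l)) r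

  extend-right : ∀ {φ m r r′ ψ ψ′} → P ψ →
    (∀ {γ} → Der P γ r′ ψ′ → Step P γ r ψ) →
    Interpolant φ m r′ ψ′ → Interpolant φ m r ψ
  extend-right pψ rule (interpolant γ pγ l r) = interpolant γ pγ l (node pγ pψ (rule r))

  conjoin : ∀ {φ m r ψ₁ ψ₂} → P (ψ₁ ∧ᶠ ψ₂) →
    Interpolant φ m r ψ₁ → Interpolant φ m r ψ₂ → Interpolant φ m r (ψ₁ ∧ᶠ ψ₂)
  conjoin pψ (interpolant γ₁ p₁ l₁ r₁) (interpolant γ₂ p₂ l₂ r₂) =
    interpolant (γ₁ ∧ᶠ γ₂) p₁₂
      (node (antecedent-in l₁) p₁₂ (∧R l₁ l₂))
      (node p₁₂ pψ (∧R (node p₁₂ (succedent-in r₁) (∧L₁ r₁))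
                       (node p₁₂ (succedent-in r₂) (∧L₂ r₂))))
    where p₁₂ = P-∧ p₁ p₂

  disjoin : ∀ {φ₁ φ₂ m r ψ} → P (φ₁ ∨ᶠ φ₂) →
    Interpolant φ₁ m r ψ → Interpolant φ₂ m r ψ → Interpolant (φ₁ ∨ᶠ φ₂) m r ψ
  disjoin pφ (interpolant γ₁ p₁ l₁ r₁) (interpolant γ₂ p₂ l₂ r₂) =
    interpolant (γ₁ ∨ᶠ γ₂) p₁₂
      (node pφ p₁₂ (∨L (node (antecedent-in l₁) p₁₂ (∨R₁ l₁))
                       (node (antecedent-in l₂) p₁₂ (∨R₂ l₂))))
      (node p₁₂ (succedent-in r₁) (∨L r₁ r₂))
    where p₁₂ = P-∨ p₁ p₂

  -- Cut ⟨φ⟩^(k + j) ⇒ ψ through χ: split inside whichever premise contains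
  -- the depth-m position, and re-attach the other premise by cut.
  interpolate-cut : ∀ {φ χ ψ k j} → P ψ → Der P φ k χ → Der P χ j ψ →
    (∀ m r → m + r ≡ k → Interpolant φ m r χ) →
    (∀ m r → m + r ≡ j → Interpolant χ m r ψ) →
    ∀ m r → m + r ≡ k + j → Interpolant φ m r ψ
  interpolate-cut {φ} {ψ = ψ} {k} {j} pψ d₁ d₂ ih₁ ih₂ m r e with split-sum m r k j e
  ... | inj₁ (t , m+t≡k , t+j≡r) =
    extend-right pψ (λ b → subst (λ i → Step P _ i ψ) t+j≡r (cut b d₂)) (ih₁ m t m+t≡k)
  ... | inj₂ (t , k+t≡m , t+r≡j) =
    extend-left (antecedent-in d₁) (λ a → subst (λ i → Step P φ i _) k+t≡m (cut d₁ a))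
      (ih₂ t r t+r≡j)

  -- Interpolation at every split m + r of the bracket depth, by induction on
  -- the derivation; the depth equation is matched as refl whenever the
  -- conclusion's depth is a variable of the rule.
  interpolate : ∀ {φ n ψ} → Der P φ n ψ → ∀ m r → m + r ≡ n → Interpolant φ m r ψ
  interpolate {φ} d zero r refl = interpolant φ (antecedent-in d) (identity (antecedent-in d)) d
  interpolate {φ} {ψ = ψ} d (suc m) zero refl =
    interpolant ψ (succedent-in d) (subst (λ i → Der P φ i ψ) (+-identityʳ (suc m)) d) (identity (succedent-in d))
  interpolate (node pφ pψ ax-bot) (suc m) (suc r) refl =
    interpolant bot pφ (node pφ pφ ax-bot) (node pφ pψ ax-bot)
  interpolate (node pφ _ (∧L₁ d)) (suc m) (suc r) refl =
    extend-left pφ ∧L₁ (interpolate d (suc m) (suc r) refl)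
  interpolate (node pφ _ (∧L₂ d)) (suc m) (suc r) refl =
    extend-left pφ ∧L₂ (interpolate d (suc m) (suc r) refl)
  interpolate (node _ pψ (∧R d₁ d₂)) (suc m) (suc r) refl =
    conjoin pψ (interpolate d₁ (suc m) (suc r) refl) (interpolate d₂ (suc m) (suc r) refl)
  interpolate (node pφ _ (∨L d₁ d₂)) (suc m) (suc r) refl =
    disjoin pφ (interpolate d₁ (suc m) (suc r) refl) (interpolate d₂ (suc m) (suc r) refl)
  interpolate (node _ pψ (∨R₁ d)) (suc m) (suc r) refl =
    extend-right pψ ∨R₁ (interpolate d (suc m) (suc r) refl)
  interpolate (node _ pψ (∨R₂ d)) (suc m) (suc r) refl =
    extend-right pψ ∨R₂ (interpolate d (suc m) (suc r) refl)
  interpolate (node pφ _ (◇L d)) (suc m) (suc r) refl =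
    extend-left pφ ◇L (interpolate d (suc (suc m)) (suc r) refl)
  interpolate (node _ pψ (◇R d)) (suc m) (suc r) refl =
    extend-right pψ ◇R (interpolate d (suc m) r (sym (+-suc m r)))
  interpolate (node pφ _ (■L d)) (suc m) (suc r) refl =
    extend-left pφ ■L (interpolate d m (suc r) refl)
  interpolate (node _ pψ (■R d)) (suc m) (suc r) refl =
    extend-right pψ ■R (interpolate d (suc m) (suc (suc r)) (cong suc (+-suc m (suc r))))
  interpolate (node _ pψ (cut d₁ d₂)) (suc m) (suc r) e =
    interpolate-cut pψ d₁ d₂ (interpolate d₁) (interpolate d₂) (suc m) (suc r) e

lemma3p3 : (T : List Fm) → top ∈ T → bot ∈ T →
    (n m : ℕ) → m ≤ n → (φ ψ : Fm) →
    T ⊢G φ ⟨ n ⟩⇒ ψ →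
    Σ Fm (λ γ → TCirc T γ × (T ⊢G φ ⟨ m ⟩⇒ γ) × (T ⊢G γ ⟨ n ∸ m ⟩⇒ ψ))
-- The theorem is interpolation for P = T° at the split m + (n ∸ m) = n.
lemma3p3 T _ _ n m m≤n φ ψ d = γ , γ∈P , left , right
  where
  open Interpolation (TCirc T) cand cor
  open Interpolant (interpolate d m (n ∸ m) (m+[n∸m]≡n m≤n))
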